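{- For every integer $n\geq4$, the wheel $W_n$ is of class $1^\pm$.
   Context: The wheel $W_n$ ($n\geq4$) is the graph on $n$ vertices consisting of a cycle $C_{n-1}$, a further vertex $v$, and edges joining $v$ to every vertex of the cycle. A signed graph is a pair $(G,\sigma)$ with $G$ a finite simple graph and $\sigma\colon E(G)\to\{\pm1\}$ a signature. An incidence is a pair $v\colon e$ with $v$ an endpoint of edge $e$; $I(G)$ is the set of incidences. For a positive integer $n$ let $M_n=\{0,\pm1,\dots,\pm k\}$ if $n=2k+1$ and $M_n=\{\pm1,\dots,\pm k\}$ if $n=2k$. An $n$-edge-coloring of $(G,\sigma)$ is a map $f\colon I(G)\to M_n$ with $f(u\colon uv)=-\sigma(uv)f(v\colon uv)$ for every edge $uv$, and $f(u\colon e_1)\neq f(u\colon e_2)$ whenever $e_1\neq e_2$ are both incident to $u$. The chromatic index $\chi'(G,\sigma)$ is the least positive integer $n$ for which an $n$-edge-coloring exists. A graph $G$ is of class $1^\pm$ if $\chi'(G,\sigma)=\Delta(G)$ for every signature $\sigma$ of $G$, where $\Delta(G)$ is the maximum degree. -}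

module Defs where

open import Data.Nat as ℕ using (ℕ; zero; suc; _≤_; _<_; _⊔_; _/_; _%_; _≡ᵇ_)
open import Data.Integer as ℤ using (ℤ; ∣_∣; -_; +_; _*_)
open import Data.Fin using (Fin; zero; suc; toℕ)
open import Data.List using (List; map; foldr; allFin)
open import Data.Nat.ListAction using (sum)
open import Data.Bool using (Bool; true; false; if_then_else_; _∨_; _∧_)
open import Data.Product using (Σ; _×_)
open import Relation.Binary.PropositionalEquality using (_≡_; _≢_)
open import Relation.Nullary using (¬_)

Graph : ℕ → Set
Graph m = Fin m → Fin m → Bool

data Sign : Set where
  plus minus : Sign

⟦_⟧ : Sign → ℤ
⟦ plus ⟧ = + 1
⟦ minus ⟧ = - (+ 1)

-- A signature of G: a sign on each edge (symmetric, since edges are unordered).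
-- Values on non-edges are irrelevant.
record Signature {m : ℕ} (G : Graph m) : Set where
  field
    σ   : Fin m → Fin m → Sign
    sym : ∀ u v → G u v ≡ true → σ u v ≡ σ v u
open Signature public

-- Membership in M_n: M_{2k+1} = {0,±1,…,±k},  M_{2k} = {±1,…,±k}.
InM : ℕ → ℤ → Set
InM n z = (∣ z ∣ ≤ n / 2) × (z ≡ + 0 → n % 2 ≡ 1)

-- An n-edge-coloring of (G,σ): f u v is the color of the incidence  u : uv.
IsEdgeColoring : {m : ℕ} (n : ℕ) (G : Graph m) (s : Signature G)
                 (f : Fin m → Fin m → ℤ) → Set
IsEdgeColoring {m} n G s f =
  (∀ u v → G u v ≡ true → InM n (f u v)) ×
  (∀ u v → G u v ≡ true → f u v ≡ - (⟦ σ s u v ⟧ * f v u)) ×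
  (∀ u v w → G u v ≡ true → G u w ≡ true → v ≢ w → f u v ≢ f u w)

Colorable : {m : ℕ} (n : ℕ) (G : Graph m) (s : Signature G) → Set
Colorable {m} n G s = Σ (Fin m → Fin m → ℤ) (IsEdgeColoring n G s)

ChromaticIndexIs : {m : ℕ} (G : Graph m) (s : Signature G) (k : ℕ) → Set
ChromaticIndexIs G s k =
  (1 ≤ k) × Colorable k G s × (∀ n → 1 ≤ n → n < k → ¬ Colorable n G s)

degree : {m : ℕ} → Graph m → Fin m → ℕ
degree {m} G u = sum (map (λ v → if G u v then 1 else 0) (allFin m))

Δ : {m : ℕ} → Graph m → ℕ
Δ {m} G = foldr _⊔_ 0 (map (degree G) (allFin m))

Class1± : {m : ℕ} → Graph m → Set
Class1± G = (s : Signature G) → ChromaticIndexIs G s (Δ G)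

cycleAdj : ℕ → ℕ → ℕ → Bool
cycleAdj k i j =
  (suc i ≡ᵇ j) ∨ (suc j ≡ᵇ i) ∨ ((i ≡ᵇ 0) ∧ (suc j ≡ᵇ k)) ∨ ((j ≡ᵇ 0) ∧ (suc i ≡ᵇ k))

-- The wheel W_n on Fin n: vertex zero is the hub v, vertices suc i
-- (i : Fin (n-1)) form the cycle C_{n-1}.
wheelAdj : (k : ℕ) → Fin (suc k) → Fin (suc k) → Bool
wheelAdj k zero zero = false
wheelAdj k zero (suc _) = true
wheelAdj k (suc _) zero = true
wheelAdj k (suc i) (suc j) = cycleAdj k (toℕ i) (toℕ j)

Wheel : (n : ℕ) → Graph n
Wheel zero = λ ()
Wheel (suc k) = wheelAdj k

-- Switching at a vertex (changing the signs of its edges and of its incident colours)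
-- transports colourings, so we may assume that every spoke of W_{k+1} is positive. A
-- k-colouring is then given by a spoke colour and a label at each rim vertex: the spoke
-- colours must be distinct, and at each rim vertex the spoke colour, the negated label and
-- the signed label of the next vertex must be distinct. For k = 2K both run through
-- 1, …, K, -1, …, -K around the rim, so consecutive labels differ in absolute value; for
-- k = 2K+1 ≥ 5 the spoke colour 0 is inserted; for k = 3 a table suffices. Conversely the
-- hub needs k distinct colours while |M_n| = n, and Δ(W_{k+1}) = k.
module Submission where

open import Defs hiding (sym)
open import Data.Nat using (ℕ; _≤_)

open import Data.Bool using (Bool; true; false; T; if_then_else_)
open import Data.Bool.Properties using (T-≡; T-∨; T-∧)
open import Data.Empty using (⊥)
open import Data.Fin as Fin using (Fin; zero; suc; toℕ)
open import Data.Fin.Properties as Finₚ using (toℕ-injective; toℕ<n; injective⇒≤; all?)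
open import Data.Integer as ℤ using (ℤ; ∣_∣; -_; +_; _*_; +[1+_]; -[1+_]; -1ℤ; 0ℤ; 1ℤ)
import Data.Integer.Properties as ℤₚ
open import Data.Integer.Tactic.RingSolver using (solve-∀)
open import Data.List using (foldr; tabulate)
open import Data.List.Properties using (map-tabulate)
import Data.Nat as ℕ
open import Data.Nat using (zero; suc; _⊔_)
open import Data.Nat.DivMod using (_mod_; m<n⇒m%n≡m; n%n≡0; m*n/n≡m; +-distrib-/; m*n%n≡0; [m+kn]%n≡m%n)
open import Data.Nat.ListAction using (sum)
import Data.Nat.Properties as ℕₚ
open import Data.Product using (_×_; _,_; proj₁; proj₂)
open import Data.Sum using (_⊎_; inj₁; inj₂)
open import Data.Vec using (Vec; []; _∷_; lookup)
open import Function using (_∘_; id; Injective)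
open import Function.Bundles using (Equivalence; _⇔_; mk⇔)
open import Relation.Binary.PropositionalEquality
open import Relation.Nullary using (Dec; does; contradiction)
open import Relation.Nullary.Decidable
  using (decidable-stable; dec-true; dec-false; _×-dec_; _→-dec_; ¬?; map′; True; toWitness)

_⊗_ : Sign → Sign → Sign
plus ⊗ b = b
minus ⊗ plus = minus
minus ⊗ minus = plus

⊗-comm : ∀ a b → a ⊗ b ≡ b ⊗ a
⊗-comm plus plus = refl
⊗-comm plus minus = refl
⊗-comm minus plus = refl
⊗-comm minus minus = refl

⊗-self : ∀ a → a ⊗ a ≡ plus
⊗-self plus = refl
⊗-self minus = refl

⟦⟧-⊗ : ∀ a b → ⟦ a ⊗ b ⟧ ≡ ⟦ a ⟧ * ⟦ b ⟧
⟦⟧-⊗ plus plus = refl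
⟦⟧-⊗ plus minus = refl
⟦⟧-⊗ minus plus = refl
⟦⟧-⊗ minus minus = refl

⟦⟧*⟦⟧≡1 : ∀ a → ⟦ a ⟧ * ⟦ a ⟧ ≡ + 1
⟦⟧*⟦⟧≡1 plus = refl
⟦⟧*⟦⟧≡1 minus = refl

⟦⟧*⟦⟧*-cancel : ∀ a z → ⟦ a ⟧ * (⟦ a ⟧ * z) ≡ z
⟦⟧*⟦⟧*-cancel a z = begin
  ⟦ a ⟧ * (⟦ a ⟧ * z)  ≡⟨ ℤₚ.*-assoc ⟦ a ⟧ ⟦ a ⟧ z ⟨
  ⟦ a ⟧ * ⟦ a ⟧ * z    ≡⟨ cong (_* z) (⟦⟧*⟦⟧≡1 a) ⟩
  + 1 * z              ≡⟨ ℤₚ.*-identityˡ z ⟩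
  z                    ∎
  where open ≡-Reasoning

⟦⟧*-injective : ∀ a {x y} → ⟦ a ⟧ * x ≡ ⟦ a ⟧ * y → x ≡ y
⟦⟧*-injective a {x} {y} eq = begin
  x                    ≡⟨ ⟦⟧*⟦⟧*-cancel a x ⟨
  ⟦ a ⟧ * (⟦ a ⟧ * x)  ≡⟨ cong (⟦ a ⟧ *_) eq ⟩
  ⟦ a ⟧ * (⟦ a ⟧ * y)  ≡⟨ ⟦⟧*⟦⟧*-cancel a y ⟩
  y                    ∎
  where open ≡-Reasoning

∣⟦⟧*∣ : ∀ a z → ∣ ⟦ a ⟧ * z ∣ ≡ ∣ z ∣
∣⟦⟧*∣ plus z = cong ∣_∣ (ℤₚ.*-identityˡ z)
∣⟦⟧*∣ minus z = trans (cong ∣_∣ (ℤₚ.-1*i≡-i z)) (ℤₚ.∣-i∣≡∣i∣ z)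

InM-neg : ∀ {n z} → InM n z → InM n (- z)
InM-neg {n} {z} (bound , zero-odd) =
  subst (ℕ._≤ n ℕ./ 2) (sym (ℤₚ.∣-i∣≡∣i∣ z)) bound , zero-odd ∘ ℤₚ.neg-injective

InM-⟦⟧* : ∀ {n z} a → InM n z → InM n (⟦ a ⟧ * z)
InM-⟦⟧* {n} {z} plus m = subst (InM n) (sym (ℤₚ.*-identityˡ z)) m
InM-⟦⟧* {n} {z} minus m = subst (InM n) (sym (ℤₚ.-1*i≡-i z)) (InM-neg {n} m)

module _ {m : ℕ} {G : Graph m} where

  switch : Signature G → (Fin m → Sign) → Signature G
  switch s η = record
    { σ   = λ u v → (η u ⊗ η v) ⊗ σ s u v
    ; sym = λ u v uv → cong₂ _⊗_ (⊗-comm (η u) (η v)) (Signature.sym s u v uv)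
    }

  colorable-switch : ∀ n (s : Signature G) (η : Fin m → Sign) →
                     Colorable n G (switch s η) → Colorable n G s
  colorable-switch n s η (g , g∈M , g-antisym , g-proper) = f , f∈M , f-antisym , f-proper
    where
    f : Fin m → Fin m → ℤ
    f u v = ⟦ η u ⟧ * g u v

    f∈M : ∀ u v → G u v ≡ true → InM n (f u v)
    f∈M u v uv = InM-⟦⟧* {n} (η u) (g∈M u v uv)

    f-antisym : ∀ u v → G u v ≡ true → f u v ≡ - (⟦ σ s u v ⟧ * f v u)
    f-antisym u v uv = begin
      ⟦ η u ⟧ * g u v
        ≡⟨ cong (⟦ η u ⟧ *_) (g-antisym u v uv) ⟩
      ⟦ η u ⟧ * - (⟦ (η u ⊗ η v) ⊗ σ s u v ⟧ * g v u)
        ≡⟨ cong (λ t → ⟦ η u ⟧ * - (t * g v u)) ⟦switched⟧ ⟩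
      ⟦ η u ⟧ * - (⟦ η u ⟧ * ⟦ η v ⟧ * ⟦ σ s u v ⟧ * g v u)
        ≡⟨ rearrange ⟦ η u ⟧ ⟦ η v ⟧ ⟦ σ s u v ⟧ (g v u) ⟩
      - (⟦ η u ⟧ * (⟦ η u ⟧ * (⟦ σ s u v ⟧ * (⟦ η v ⟧ * g v u))))
        ≡⟨ cong -_ (⟦⟧*⟦⟧*-cancel (η u) _) ⟩
      - (⟦ σ s u v ⟧ * f v u) ∎
      where
      open ≡-Reasoning
      ⟦switched⟧ : ⟦ (η u ⊗ η v) ⊗ σ s u v ⟧ ≡ ⟦ η u ⟧ * ⟦ η v ⟧ * ⟦ σ s u v ⟧
      ⟦switched⟧ = trans (⟦⟧-⊗ (η u ⊗ η v) (σ s u v)) (cong (_* ⟦ σ s u v ⟧) (⟦⟧-⊗ (η u) (η v)))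
      rearrange : ∀ a b c d → a * - (a * b * c * d) ≡ - (a * (a * (c * (b * d))))
      rearrange = solve-∀

    f-proper : ∀ u v w → G u v ≡ true → G u w ≡ true → v ≢ w → f u v ≢ f u w
    f-proper u v w uv uw v≢w = g-proper u v w uv uw v≢w ∘ ⟦⟧*-injective (η u)

next : ∀ {k} → Fin k → Fin k
next {suc m} i = suc (toℕ i) mod suc m

data NextView {k} (i : Fin k) : Set where
  wraps : suc (toℕ i) ≡ k → toℕ (next i) ≡ 0 → NextView i
  steps : suc (toℕ i) ℕ.< k → toℕ (next i) ≡ suc (toℕ i) → NextView i

nextView : ∀ {k} (i : Fin k) → NextView i
nextView {suc m} i with ℕₚ.m≤n⇒m<n∨m≡n (toℕ<n i)
... | inj₁ i+1<k = steps i+1<k (trans (Finₚ.toℕ-fromℕ< _) (m<n⇒m%n≡m i+1<k))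
... | inj₂ i+1≡k =
  wraps i+1≡k (trans (Finₚ.toℕ-fromℕ< _) (trans (cong (ℕ._% suc m) i+1≡k) (n%n≡0 (suc m))))

next-injective : ∀ {k} → Injective _≡_ _≡_ (next {k})
next-injective {x = i} {j} eq with nextView i | nextView j
... | wraps i+1≡k _ | wraps j+1≡k _ = toℕ-injective (ℕₚ.suc-injective (trans i+1≡k (sym j+1≡k)))
... | steps _ ni≡i+1 | steps _ nj≡j+1 =
  toℕ-injective (ℕₚ.suc-injective (trans (sym ni≡i+1) (trans (cong toℕ eq) nj≡j+1)))
... | wraps _ ni≡0 | steps _ nj≡j+1 with () ← trans (sym ni≡0) (trans (cong toℕ eq) nj≡j+1)
... | steps _ ni≡i+1 | wraps _ nj≡0 with () ← trans (sym nj≡0) (trans (cong toℕ (sym eq)) ni≡i+1)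

next-of-successor : ∀ {k} {i j : Fin k} → suc (toℕ i) ≡ toℕ j → j ≡ next i
next-of-successor {i = i} {j} i+1≡j with nextView i
... | wraps i+1≡k _ = contradiction (trans (sym i+1≡k) i+1≡j) (ℕₚ.<⇒≢ (toℕ<n j) ∘ sym)
... | steps _ ni≡i+1 = toℕ-injective (trans (sym i+1≡j) (sym ni≡i+1))

next-of-last : ∀ {k} {i j : Fin k} → suc (toℕ i) ≡ k → toℕ j ≡ 0 → j ≡ next i
next-of-last {i = i} i+1≡k j≡0 with nextView i
... | wraps _ ni≡0 = toℕ-injective (trans j≡0 (sym ni≡0))
... | steps i+1<k _ = contradiction i+1≡k (ℕₚ.<⇒≢ i+1<k)

cycleAdj⇒next : ∀ {k} (i j : Fin k) → cycleAdj k (toℕ i) (toℕ j) ≡ true → j ≡ next i ⊎ i ≡ next j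
cycleAdj⇒next {k} i j adj with Equivalence.to T-∨ (Equivalence.from T-≡ adj)
... | inj₁ i+1≡j = inj₁ (next-of-successor (ℕₚ.≡ᵇ⇒≡ _ _ i+1≡j))
... | inj₂ adj′ with Equivalence.to T-∨ adj′
...   | inj₁ j+1≡i = inj₂ (next-of-successor (ℕₚ.≡ᵇ⇒≡ _ _ j+1≡i))
...   | inj₂ adj″ with Equivalence.to T-∨ adj″
...     | inj₁ i0∧j+1k = let i≡0 , j+1≡k = Equivalence.to T-∧ i0∧j+1k in
                         inj₂ (next-of-last (ℕₚ.≡ᵇ⇒≡ _ k j+1≡k) (ℕₚ.≡ᵇ⇒≡ _ 0 i≡0))
...     | inj₂ j0∧i+1k = let j≡0 , i+1≡k = Equivalence.to T-∧ j0∧i+1k in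
                         inj₁ (next-of-last (ℕₚ.≡ᵇ⇒≡ _ k i+1≡k) (ℕₚ.≡ᵇ⇒≡ _ 0 j≡0))

next∘next≢id : ∀ {k} → 3 ≤ k → (i : Fin k) → next (next i) ≢ i
next∘next≢id {k} 3≤k i nni≡i = go (nextView i) (nextView (next i))
  where
  i≡nni : toℕ i ≡ toℕ (next (next i))
  i≡nni = cong toℕ (sym nni≡i)

  k≢2 : k ≢ 2
  k≢2 k≡2 = ℕₚ.<-irrefl (sym k≡2) 3≤k

  go : NextView i → NextView (next i) → ⊥
  go (steps _ ni≡i+1) (steps _ nni≡ni+1) =
    ℕₚ.<-irrefl (trans i≡nni (trans nni≡ni+1 (cong suc ni≡i+1))) (ℕₚ.m<n+m (toℕ i) {2} ℕ.z<s)
  go (wraps i+1≡k ni≡0) (steps _ nni≡ni+1) =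
    k≢2 (trans (sym i+1≡k) (cong suc (trans i≡nni (trans nni≡ni+1 (cong suc ni≡0)))))
  go (steps _ ni≡i+1) (wraps ni+1≡k nni≡0) =
    k≢2 (trans (sym ni+1≡k) (cong suc (trans ni≡i+1 (cong suc (trans i≡nni nni≡0)))))
  go (wraps _ ni≡0) (wraps ni+1≡k _) =
    ℕₚ.<-irrefl (trans (cong suc (sym ni≡0)) ni+1≡k) (ℕₚ.≤-trans (ℕ.s≤s (ℕ.s≤s ℕ.z≤n)) 3≤k)

Distinct₃ : ℤ → ℤ → ℤ → Set
Distinct₃ x y z = x ≢ y × x ≢ z × y ≢ z

-- With all spokes positive, rim vertex i gets colour spoke i on its spoke (the hub gets
-- - spoke i), - label i towards its predecessor and ⟦ τ i ⟧ * label (next i) towards next i,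
-- where τ i is the sign of that rim edge; the sign condition on rim edges then holds by construction.
record IsRimLabelling (k : ℕ) (τ : Fin k → Sign) (spoke label : Fin k → ℤ) : Set where
  field
    spoke∈M         : ∀ i → InM k (spoke i)
    label∈M         : ∀ i → InM k (label i)
    spoke-injective : Injective _≡_ _≡_ spoke
    distinct        : ∀ i → Distinct₃ (spoke i) (- label i) (⟦ τ i ⟧ * label (next i))

record RimLabelling (k : ℕ) (τ : Fin k → Sign) : Set where
  field
    spoke label    : Fin k → ℤ
    isRimLabelling : IsRimLabelling k τ spoke label
  open IsRimLabelling isRimLabelling public

rimSign : ∀ {k} → Signature (wheelAdj k) → Fin k → Sign
rimSign s i = σ s (suc i) (suc (next i))

data RimNeighbour {k} (i : Fin k) : Fin (suc k) → Set where
  hub  : RimNeighbour i zero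
  succ : RimNeighbour i (suc (next i))
  pred : ∀ {j} → next j ≡ i → RimNeighbour i (suc j)

rimNeighbour : ∀ {k} (i : Fin k) v → wheelAdj k (suc i) v ≡ true → RimNeighbour i v
rimNeighbour i zero _ = hub
rimNeighbour i (suc j) adj with cycleAdj⇒next i j adj
... | inj₁ refl = succ
... | inj₂ i≡nj = pred (sym i≡nj)

module _ {k} (3≤k : 3 ≤ k) (s : Signature (wheelAdj k))
         (spokes+ : ∀ i → σ s zero (suc i) ≡ plus) (L : RimLabelling k (rimSign s)) where

  open RimLabelling L

  color : Fin (suc k) → Fin (suc k) → ℤ
  color zero    zero    = + 0
  color zero    (suc j) = - spoke j
  color (suc i) zero    = spoke i
  color (suc i) (suc j) = if does (j Finₚ.≟ next i) then ⟦ σ s (suc i) (suc j) ⟧ * label j else - label i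

  neighbourColor : ∀ {i : Fin k} {v} → RimNeighbour i v → ℤ
  neighbourColor {i} hub      = spoke i
  neighbourColor {i} succ     = ⟦ rimSign s i ⟧ * label (next i)
  neighbourColor {i} (pred _) = - label i

  color-neighbour : ∀ {i : Fin k} {v} (n : RimNeighbour i v) → color (suc i) v ≡ neighbourColor n
  color-neighbour hub = refl
  color-neighbour {i} succ =
    cong (λ b → if b then ⟦ rimSign s i ⟧ * label (next i) else - label i)
         (dec-true (next i Finₚ.≟ next i) refl)
  color-neighbour {i} (pred {j} nj≡i) =
    cong (λ b → if b then ⟦ σ s (suc i) (suc j) ⟧ * label j else - label i)
         (dec-false (j Finₚ.≟ next i) j≢ni)
    where
    j≢ni : j ≢ next i
    j≢ni j≡ni = next∘next≢id 3≤k i (trans (cong next (sym j≡ni)) nj≡i)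

  neighbourColor-injective : ∀ {i : Fin k} {v w} (n : RimNeighbour i v) (n′ : RimNeighbour i w) →
                             neighbourColor n ≡ neighbourColor n′ → v ≡ w
  neighbourColor-injective hub      hub       _ = refl
  neighbourColor-injective succ     succ      _ = refl
  neighbourColor-injective (pred p) (pred p′) _ = cong suc (next-injective (trans p (sym p′)))
  neighbourColor-injective {i} hub      (pred _) eq = contradiction eq (proj₁ (distinct i))
  neighbourColor-injective {i} hub      succ     eq = contradiction eq (proj₁ (proj₂ (distinct i)))
  neighbourColor-injective {i} (pred _) succ     eq = contradiction eq (proj₂ (proj₂ (distinct i)))
  neighbourColor-injective {i} (pred _) hub      eq = contradiction (sym eq) (proj₁ (distinct i))
  neighbourColor-injective {i} succ     hub      eq = contradiction (sym eq) (proj₁ (proj₂ (distinct i)))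
  neighbourColor-injective {i} succ     (pred _) eq = contradiction (sym eq) (proj₂ (proj₂ (distinct i)))

  neighbourColor∈M : ∀ {i : Fin k} {v} (n : RimNeighbour i v) → InM k (neighbourColor n)
  neighbourColor∈M {i} hub      = spoke∈M i
  neighbourColor∈M {i} succ     = InM-⟦⟧* {k} (rimSign s i) (label∈M (next i))
  neighbourColor∈M {i} (pred _) = InM-neg {k} (label∈M i)

  color∈M : ∀ u v → wheelAdj k u v ≡ true → InM k (color u v)
  color∈M zero    (suc j) _   = InM-neg {k} (spoke∈M j)
  color∈M (suc i) v       adj =
    subst (InM k) (sym (color-neighbour n)) (neighbourColor∈M n)
    where
    n : RimNeighbour i v
    n = rimNeighbour i v adj

  color-proper : ∀ u v w → wheelAdj k u v ≡ true → wheelAdj k u w ≡ true → v ≢ w → color u v ≢ color u w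
  color-proper zero (suc j) (suc j′) _ _ v≢w eq = v≢w (cong suc (spoke-injective (ℤₚ.neg-injective eq)))
  color-proper (suc i) v w uv uw v≢w eq =
    v≢w (neighbourColor-injective n n′ (trans (sym (color-neighbour n)) (trans eq (color-neighbour n′))))
    where
    n : RimNeighbour i v
    n = rimNeighbour i v uv
    n′ : RimNeighbour i w
    n′ = rimNeighbour i w uw

  color-antisym : ∀ u v → wheelAdj k u v ≡ true → color u v ≡ - (⟦ σ s u v ⟧ * color v u)
  color-antisym zero (suc j) _ rewrite spokes+ j = cong -_ (sym (ℤₚ.*-identityˡ _))
  color-antisym (suc i) zero _ rewrite Signature.sym s (suc i) zero refl | spokes+ i =
    sym (trans (cong -_ (ℤₚ.*-identityˡ _)) (ℤₚ.neg-involutive _))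
  color-antisym (suc i) (suc j) adj with rimNeighbour i (suc j) adj
  ... | succ = begin
    color (suc i) (suc (next i))            ≡⟨ color-neighbour succ ⟩
    ⟦ t ⟧ * label (next i)                  ≡⟨ ℤₚ.neg-involutive _ ⟨
    - - (⟦ t ⟧ * label (next i))            ≡⟨ cong -_ (ℤₚ.neg-distribʳ-* ⟦ t ⟧ _) ⟩
    - (⟦ t ⟧ * - label (next i))            ≡⟨ cong (λ c → - (⟦ t ⟧ * c)) (color-neighbour (pred refl)) ⟨
    - (⟦ t ⟧ * color (suc (next i)) (suc i)) ∎
    where
    open ≡-Reasoning
    t : Sign
    t = rimSign s i
  ... | pred {j} refl = begin
    color (suc (next j)) (suc j)
      ≡⟨ color-neighbour (pred refl) ⟩
    - label (next j)
      ≡⟨ cong -_ (⟦⟧*⟦⟧*-cancel t _) ⟨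
    - (⟦ t ⟧ * (⟦ t ⟧ * label (next j)))
      ≡⟨ cong (λ t′ → - (⟦ t ⟧ * (⟦ t′ ⟧ * label (next j)))) t≡τj ⟩
    - (⟦ t ⟧ * (⟦ rimSign s j ⟧ * label (next j)))
      ≡⟨ cong (λ c → - (⟦ t ⟧ * c)) (color-neighbour succ) ⟨
    - (⟦ t ⟧ * color (suc j) (suc (next j))) ∎
    where
    open ≡-Reasoning
    t : Sign
    t = σ s (suc (next j)) (suc j)
    t≡τj : t ≡ rimSign s j
    t≡τj = Signature.sym s (suc (next j)) (suc j) adj

  colorable-fromRimLabelling : Colorable k (wheelAdj k) s
  colorable-fromRimLabelling = color , color∈M , color-antisym , color-proper

wheel-colorable : ∀ {k} → 3 ≤ k → (∀ τ → RimLabelling k τ) → ∀ s → Colorable k (wheelAdj k) s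
wheel-colorable {k} 3≤k labelling s =
  colorable-switch k s η (colorable-fromRimLabelling 3≤k s′ spokes+ (labelling (rimSign s′)))
  where
  η : Fin (suc k) → Sign
  η zero    = plus
  η (suc i) = σ s zero (suc i)

  s′ : Signature (wheelAdj k)
  s′ = switch s η

  spokes+ : ∀ i → σ s′ zero (suc i) ≡ plus
  spokes+ i = ⊗-self (σ s zero (suc i))

x≢-x : ∀ {x} → x ≢ + 0 → x ≢ - x
x≢-x {+[1+ _ ]} _ ()
x≢-x {+ 0} x≢0 _ = x≢0 refl
x≢-x { -[1+ _ ]} _ ()

distinct-by-abs : ∀ {x y} t → x ≢ + 0 → ∣ x ∣ ≢ ∣ y ∣ → Distinct₃ x (- x) (⟦ t ⟧ * y)
distinct-by-abs {x} {y} t x≢0 ∣x∣≢∣y∣ =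
    x≢-x x≢0
  , (λ eq → ∣x∣≢∣y∣ (trans (cong ∣_∣ eq) (∣⟦⟧*∣ t y)))
  , (λ eq → ∣x∣≢∣y∣ (trans (sym (ℤₚ.∣-i∣≡∣i∣ x)) (trans (cong ∣_∣ eq) (∣⟦⟧*∣ t y))))

enum : ℕ → ℕ → ℤ
enum K r = if r ℕ.<ᵇ K then +[1+ r ] else -[1+ r ℕ.∸ K ]

data EnumView (K r : ℕ) : Set where
  positive : r ℕ.< K → enum K r ≡ +[1+ r ] → EnumView K r
  negative : K ≤ r → enum K r ≡ -[1+ r ℕ.∸ K ] → EnumView K r

enumView : ∀ K r → EnumView K r
enumView K r = view (r ℕ.<ᵇ K) refl
  where
  select : Bool → ℤ
  select b = if b then +[1+ r ] else -[1+ r ℕ.∸ K ]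

  view : ∀ b → (r ℕ.<ᵇ K) ≡ b → EnumView K r
  view true  r<ᵇK = positive (ℕₚ.<ᵇ⇒< r K (subst T (sym r<ᵇK) _)) (cong select r<ᵇK)
  view false r<ᵇK = negative (ℕₚ.≮⇒≥ λ r<K → subst T r<ᵇK (ℕₚ.<⇒<ᵇ r<K)) (cong select r<ᵇK)

enum≢0 : ∀ K r → enum K r ≢ + 0
enum≢0 K r eq with enumView K r
... | positive _ e with () ← trans (sym e) eq
... | negative _ e with () ← trans (sym e) eq

enum-injective : ∀ K → Injective _≡_ _≡_ (enum K)
enum-injective K {r} {r′} eq with enumView K r | enumView K r′
... | positive _ e | positive _ e′ = ℕₚ.suc-injective (cong ∣_∣ (trans (sym e) (trans eq e′)))
... | negative K≤r e | negative K≤r′ e′ =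
  ℕₚ.∸-cancelʳ-≡ K≤r K≤r′ (ℕₚ.suc-injective (cong ∣_∣ (trans (sym e) (trans eq e′))))
... | positive _ e | negative _ e′ with () ← trans (sym e) (trans eq e′)
... | negative _ e | positive _ e′ with () ← trans (sym e) (trans eq e′)

∣enum∣≤ : ∀ K r → r ℕ.< K ℕ.+ K → ∣ enum K r ∣ ≤ K
∣enum∣≤ K r r<2K with enumView K r
... | positive r<K e rewrite e = r<K
... | negative K≤r e rewrite e =
  ℕₚ.+-cancelʳ-< K (r ℕ.∸ K) K (subst (ℕ._< K ℕ.+ K) (sym (ℕₚ.m∸n+n≡m K≤r)) r<2K)

∣enum∣-last : ∀ K r → suc r ≡ K ℕ.+ K → ∣ enum K r ∣ ≡ K
∣enum∣-last K r r+1≡2K with enumView K r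
... | positive r<K _ =
  contradiction (subst (ℕ._≤ K) r+1≡2K r<K) (ℕₚ.<⇒≱ (ℕₚ.m<m+n K (ℕₚ.≤-trans (ℕ.s≤s ℕ.z≤n) r<K)))
... | negative K≤r e rewrite e =
  trans (sym (ℕₚ.+-∸-assoc 1 K≤r)) (trans (cong (ℕ._∸ K) r+1≡2K) (ℕₚ.m+n∸m≡n K K))

∣enum∣-step : ∀ K r → 2 ≤ K → suc r ℕ.< K ℕ.+ K → ∣ enum K r ∣ ≢ ∣ enum K (suc r) ∣
∣enum∣-step K r 2≤K _ eq with enumView K r | enumView K (suc r)
... | positive _ e | positive _ e′ =
  ℕₚ.<-irrefl (trans (cong ∣_∣ (sym e)) (trans eq (cong ∣_∣ e′))) (ℕₚ.n<1+n (suc r))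
... | positive r<K e | negative K≤r+1 e′ = ℕₚ.<-irrefl (sym K≡1) 2≤K
  where
  open ≡-Reasoning
  K≡r+1 : K ≡ suc r
  K≡r+1 = ℕₚ.≤-antisym K≤r+1 r<K
  K≡1 : K ≡ 1
  K≡1 = begin
    K                      ≡⟨ K≡r+1 ⟩
    suc r                  ≡⟨ cong ∣_∣ e ⟨
    ∣ enum K r ∣           ≡⟨ eq ⟩
    ∣ enum K (suc r) ∣     ≡⟨ cong ∣_∣ e′ ⟩
    suc (suc r ℕ.∸ K)      ≡⟨ cong (λ x → suc (x ℕ.∸ K)) K≡r+1 ⟨
    suc (K ℕ.∸ K)          ≡⟨ cong suc (ℕₚ.n∸n≡0 K) ⟩
    1                      ∎
... | negative K≤r _ | positive r+1<K _ = ℕₚ.<-asym (ℕₚ.<-≤-trans r+1<K K≤r) (ℕₚ.n<1+n r) 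
... | negative K≤r e | negative _ e′ =
  ℕₚ.<-irrefl (trans (cong ∣_∣ (sym e)) (trans eq (trans (cong ∣_∣ e′) (cong suc (ℕₚ.+-∸-assoc 1 K≤r)))))
              (ℕₚ.n<1+n (suc (r ℕ.∸ K)))

data Parity : ℕ → Set where
  even : ∀ K → Parity (K ℕ.+ K)
  odd  : ∀ K → Parity (suc (K ℕ.+ K))

parityView : ∀ n → Parity n
parityView zero = even 0
parityView (suc n) with parityView n
... | even K = odd K
... | odd K  = subst Parity (cong suc (ℕₚ.+-suc K K)) (even (suc K))

K+K≡K*2 : ∀ K → K ℕ.+ K ≡ K ℕ.* 2
K+K≡K*2 K = trans (cong (K ℕ.+_) (sym (ℕₚ.+-identityʳ K))) (ℕₚ.*-comm 2 K)

[K+K]/2≡K : ∀ K → (K ℕ.+ K) ℕ./ 2 ≡ K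
[K+K]/2≡K K = trans (cong (ℕ._/ 2) (K+K≡K*2 K)) (m*n/n≡m K 2)

[K+K]%2≡0 : ∀ K → (K ℕ.+ K) ℕ.% 2 ≡ 0
[K+K]%2≡0 K = trans (cong (ℕ._% 2) (K+K≡K*2 K)) (m*n%n≡0 K 2)

[1+K+K]/2≡K : ∀ K → suc (K ℕ.+ K) ℕ./ 2 ≡ K
[1+K+K]/2≡K K = begin
  suc (K ℕ.+ K) ℕ./ 2   ≡⟨ cong (λ n → suc n ℕ./ 2) (K+K≡K*2 K) ⟩
  (1 ℕ.+ K ℕ.* 2) ℕ./ 2 ≡⟨ +-distrib-/ 1 (K ℕ.* 2) (subst (λ m → 1 ℕ.+ m ℕ.< 2) (sym (m*n%n≡0 K 2)) ℕₚ.≤-refl) ⟩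
  K ℕ.* 2 ℕ./ 2         ≡⟨ m*n/n≡m K 2 ⟩
  K                     ∎
  where open ≡-Reasoning

[1+K+K]%2≡1 : ∀ K → suc (K ℕ.+ K) ℕ.% 2 ≡ 1
[1+K+K]%2≡1 K = trans (cong (λ n → suc n ℕ.% 2) (K+K≡K*2 K)) ([m+kn]%n≡m%n 1 K 2)

InM-even : ∀ K {z} → InM (K ℕ.+ K) z ⇔ (∣ z ∣ ≤ K × z ≢ + 0)
InM-even K {z} = mk⇔
  (λ (bound , zero-odd) → subst (∣ z ∣ ≤_) ([K+K]/2≡K K) bound
                        , λ z≡0 → contradiction (trans (sym ([K+K]%2≡0 K)) (zero-odd z≡0)) λ ())
  (λ (bound , z≢0) → subst (∣ z ∣ ≤_) (sym ([K+K]/2≡K K)) bound , λ z≡0 → contradiction z≡0 z≢0)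

InM-odd : ∀ K {z} → InM (suc (K ℕ.+ K)) z ⇔ ∣ z ∣ ≤ K
InM-odd K {z} = mk⇔
  (λ (bound , _) → subst (∣ z ∣ ≤_) ([1+K+K]/2≡K K) bound)
  (λ bound → subst (∣ z ∣ ≤_) (sym ([1+K+K]/2≡K K)) bound , λ _ → [1+K+K]%2≡1 K)

enum-zero : ∀ K → 0 ℕ.< K → enum K 0 ≡ + 1
enum-zero K 0<K with enumView K 0
... | positive _ e = e
... | negative K≤0 _ = contradiction K≤0 (ℕₚ.<⇒≱ 0<K)

∣⟦⟧∣≡1 : ∀ a → ∣ ⟦ a ⟧ ∣ ≡ 1
∣⟦⟧∣≡1 plus = refl
∣⟦⟧∣≡1 minus = refl

distinct-at-zero : ∀ t → Distinct₃ (+ 0) (- ⟦ t ⟧) (⟦ t ⟧ * + 1)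
distinct-at-zero plus = (λ ()) , (λ ()) , (λ ())
distinct-at-zero minus = (λ ()) , (λ ()) , (λ ())

evenRimLabelling : ∀ {K} → 2 ≤ K → (τ : Fin (K ℕ.+ K) → Sign) → RimLabelling (K ℕ.+ K) τ
evenRimLabelling {K} 2≤K τ = record
  { spoke          = enum K ∘ toℕ
  ; label          = enum K ∘ toℕ
  ; isRimLabelling = record
    { spoke∈M         = enum∈M
    ; label∈M         = enum∈M
    ; spoke-injective = toℕ-injective ∘ enum-injective K
    ; distinct        = λ i → distinct-by-abs (τ i) (enum≢0 K (toℕ i)) (∣enum∣-next i)
    }
  }
  where
  enum∈M : ∀ i → InM (K ℕ.+ K) (enum K (toℕ i))
  enum∈M i = Equivalence.from (InM-even K) (∣enum∣≤ K (toℕ i) (toℕ<n i) , enum≢0 K (toℕ i))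

  K≢1 : K ≢ 1
  K≢1 K≡1 = ℕₚ.<-irrefl (sym K≡1) 2≤K

  ∣enum∣-next : ∀ i → ∣ enum K (toℕ i) ∣ ≢ ∣ enum K (toℕ (next i)) ∣
  ∣enum∣-next i with nextView i
  ... | steps i+1<2K ni≡i+1 rewrite ni≡i+1 = ∣enum∣-step K (toℕ i) 2≤K i+1<2K
  ... | wraps i+1≡2K ni≡0 rewrite ni≡0 | ∣enum∣-last K (toℕ i) i+1≡2K | enum-zero K (ℕₚ.<-trans ℕ.z<s 2≤K) =
    K≢1

-- The colour 0 goes to the spoke at rim vertex 0; its label ⟦ τ 0 ⟧ gives the two rim
-- incidences at that vertex the colours ∓ ⟦ τ 0 ⟧.
oddRimLabelling : ∀ {K} → 2 ≤ K → (τ : Fin (suc (K ℕ.+ K)) → Sign) → RimLabelling (suc (K ℕ.+ K)) τ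
oddRimLabelling {K} 2≤K τ = record
  { spoke          = spokeℕ ∘ toℕ
  ; label          = labelℕ ∘ toℕ
  ; isRimLabelling = record
    { spoke∈M         = spoke∈M
    ; label∈M         = label∈M
    ; spoke-injective = spoke-injective
    ; distinct        = distinct
    }
  }
  where
  spokeℕ labelℕ : ℕ → ℤ
  spokeℕ zero    = + 0
  spokeℕ (suc r) = enum K r
  labelℕ zero    = ⟦ τ zero ⟧
  labelℕ (suc r) = enum K r

  1≤K : 1 ≤ K
  1≤K = ℕₚ.<-trans ℕ.z<s 2≤K

  K≢1 : K ≢ 1
  K≢1 K≡1 = ℕₚ.<-irrefl (sym K≡1) 2≤K

  spoke∈M : ∀ i → InM (suc (K ℕ.+ K)) (spokeℕ (toℕ i))
  spoke∈M zero    = Equivalence.from (InM-odd K) ℕ.z≤n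
  spoke∈M (suc i) = Equivalence.from (InM-odd K) (∣enum∣≤ K (toℕ i) (toℕ<n i))

  label∈M : ∀ i → InM (suc (K ℕ.+ K)) (labelℕ (toℕ i))
  label∈M zero    = Equivalence.from (InM-odd K) (subst (_≤ K) (sym (∣⟦⟧∣≡1 (τ zero))) 1≤K)
  label∈M (suc i) = spoke∈M (suc i)

  spoke-injective : Injective _≡_ _≡_ (spokeℕ ∘ toℕ)
  spoke-injective {zero}  {zero}  _  = refl
  spoke-injective {suc i} {suc j} eq = cong suc (toℕ-injective (enum-injective K eq))
  spoke-injective {zero}  {suc j} eq = contradiction (sym eq) (enum≢0 K (toℕ j))
  spoke-injective {suc i} {zero}  eq = contradiction eq (enum≢0 K (toℕ i))

  distinct : ∀ i → Distinct₃ (spokeℕ (toℕ i)) (- labelℕ (toℕ i)) (⟦ τ i ⟧ * labelℕ (toℕ (next i)))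
  distinct zero with nextView (zero {K ℕ.+ K})
  ... | steps _ n0≡1 rewrite n0≡1 | enum-zero K 1≤K = distinct-at-zero (τ zero)
  ... | wraps 1≡k _ = contradiction (ℕₚ.suc-injective 1≡k) (ℕₚ.<⇒≢ (ℕₚ.<-≤-trans 1≤K (ℕₚ.m≤m+n K K)))
  distinct (suc i) with nextView (suc i)
  ... | steps i+2<k n≡i+2 rewrite n≡i+2 =
    distinct-by-abs (τ (suc i)) (enum≢0 K (toℕ i)) (∣enum∣-step K (toℕ i) 2≤K (ℕ.s≤s⁻¹ i+2<k))
  ... | wraps i+2≡k n≡0 rewrite n≡0 =
    distinct-by-abs (τ (suc i)) (enum≢0 K (toℕ i)) λ eq →
      K≢1 (trans (sym (∣enum∣-last K (toℕ i) (ℕₚ.suc-injective i+2≡k))) (trans eq (∣⟦⟧∣≡1 (τ zero))))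

InM? : ∀ n z → Dec (InM n z)
InM? n z = (∣ z ∣ ℕ.≤? n ℕ./ 2) ×-dec ((z ℤ.≟ + 0) →-dec (n ℕ.% 2 ℕ.≟ 1))

Distinct₃? : ∀ x y z → Dec (Distinct₃ x y z)
Distinct₃? x y z = ¬? (x ℤ.≟ y) ×-dec ¬? (x ℤ.≟ z) ×-dec ¬? (y ℤ.≟ z)

injective? : ∀ {k} (f : Fin k → ℤ) → Dec (Injective _≡_ _≡_ f)
injective? f = map′ (λ inj {i} {j} → inj i j) (λ inj i j → inj {i} {j})
                    (all? λ i → all? λ j → (f i ℤ.≟ f j) →-dec (i Finₚ.≟ j))

isRimLabelling? : ∀ k τ spoke label → Dec (IsRimLabelling k τ spoke label)
isRimLabelling? k τ spoke label =
  map′ fromParts toParts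
       (all? (InM? k ∘ spoke) ×-dec all? (InM? k ∘ label) ×-dec injective? spoke ×-dec
        all? λ i → Distinct₃? (spoke i) (- label i) (⟦ τ i ⟧ * label (next i)))
  where
  Parts : Set
  Parts = (∀ i → InM k (spoke i)) × (∀ i → InM k (label i)) × Injective _≡_ _≡_ spoke ×
          (∀ i → Distinct₃ (spoke i) (- label i) (⟦ τ i ⟧ * label (next i)))

  fromParts : Parts → IsRimLabelling k τ spoke label
  fromParts (s∈M , l∈M , inj , dist) =
    record { spoke∈M = s∈M ; label∈M = l∈M ; spoke-injective = inj ; distinct = dist }

  toParts : IsRimLabelling k τ spoke label → Parts
  toParts L = spoke∈M , label∈M , spoke-injective , distinct
    where open IsRimLabelling L

rimLabellingFromTable : ∀ {k τ} (spoke label : Vec ℤ k) →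
                        {True (isRimLabelling? k τ (lookup spoke) (lookup label))} → RimLabelling k τ
rimLabellingFromTable spoke label {valid} = record
  { spoke = lookup spoke ; label = lookup label ; isRimLabelling = toWitness valid }

RimLabelling-cong : ∀ {k} {τ τ′ : Fin k → Sign} →
                    (∀ i → τ i ≡ τ′ i) → RimLabelling k τ → RimLabelling k τ′
RimLabelling-cong τ≗τ′ L = record
  { spoke = spoke ; label = label ; isRimLabelling = record
    { spoke∈M = spoke∈M ; label∈M = label∈M ; spoke-injective = spoke-injective
    ; distinct = λ i → subst (λ t → Distinct₃ _ _ (⟦ t ⟧ * label (next i))) (τ≗τ′ i) (distinct i) } }
  where open RimLabelling L

-- The colour 0 goes to the spoke at a rim vertex whose two rim edges have equal signs;
-- on a triangle such a vertex always exists.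
triangleTable : ∀ a b c → RimLabelling 3 (lookup (a ∷ b ∷ c ∷ []))
triangleTable plus  plus  plus  = rimLabellingFromTable (1ℤ ∷ -1ℤ ∷ 0ℤ ∷ []) (1ℤ ∷ 0ℤ ∷ 1ℤ ∷ [])
triangleTable plus  plus  minus = rimLabellingFromTable (-1ℤ ∷ 0ℤ ∷ 1ℤ ∷ []) (0ℤ ∷ 1ℤ ∷ 1ℤ ∷ [])
triangleTable plus  minus plus  = rimLabellingFromTable (0ℤ ∷ 1ℤ ∷ -1ℤ ∷ []) (1ℤ ∷ 1ℤ ∷ 0ℤ ∷ [])
triangleTable plus  minus minus = rimLabellingFromTable (1ℤ ∷ -1ℤ ∷ 0ℤ ∷ []) (1ℤ ∷ 0ℤ ∷ -1ℤ ∷ [])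
triangleTable minus plus  plus  = rimLabellingFromTable (1ℤ ∷ -1ℤ ∷ 0ℤ ∷ []) (1ℤ ∷ 0ℤ ∷ 1ℤ ∷ [])
triangleTable minus plus  minus = rimLabellingFromTable (0ℤ ∷ 1ℤ ∷ -1ℤ ∷ []) (-1ℤ ∷ 1ℤ ∷ 0ℤ ∷ [])
triangleTable minus minus plus  = rimLabellingFromTable (-1ℤ ∷ 0ℤ ∷ 1ℤ ∷ []) (0ℤ ∷ -1ℤ ∷ 1ℤ ∷ [])
triangleTable minus minus minus = rimLabellingFromTable (1ℤ ∷ -1ℤ ∷ 0ℤ ∷ []) (1ℤ ∷ 0ℤ ∷ -1ℤ ∷ [])

triangleRimLabelling : ∀ τ → RimLabelling 3 τ
triangleRimLabelling τ =
  RimLabelling-cong τ≗ (triangleTable (τ zero) (τ (suc zero)) (τ (suc (suc zero))))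
  where
  τ≗ : ∀ i → lookup (τ zero ∷ τ (suc zero) ∷ τ (suc (suc zero)) ∷ []) i ≡ τ i
  τ≗ zero = refl
  τ≗ (suc zero) = refl
  τ≗ (suc (suc zero)) = refl

rimLabelling : ∀ k → 3 ≤ k → ∀ τ → RimLabelling k τ
rimLabelling k = byParity (parityView k)
  where
  byParity : ∀ {k} → Parity k → 3 ≤ k → ∀ τ → RimLabelling k τ
  byParity (even (suc (suc K))) _ = evenRimLabelling (ℕ.s≤s (ℕ.s≤s ℕ.z≤n))
  byParity (odd (suc (suc K)))  _ = oddRimLabelling (ℕ.s≤s (ℕ.s≤s ℕ.z≤n))
  byParity (odd 1)              _ = triangleRimLabelling
  byParity (even 0)             ()
  byParity (even 1)             (ℕ.s≤s (ℕ.s≤s ()))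
  byParity (odd 0)              (ℕ.s≤s ())

m*2≢1+n*2 : ∀ m n → m ℕ.* 2 ≢ suc (n ℕ.* 2)
m*2≢1+n*2 zero    n       ()
m*2≢1+n*2 (suc m) zero    ()
m*2≢1+n*2 (suc m) (suc n) eq = m*2≢1+n*2 m n (ℕₚ.suc-injective (ℕₚ.suc-injective eq))

nonzeroCode : ℤ → ℕ
nonzeroCode (+ 0)    = 0
nonzeroCode +[1+ m ] = m ℕ.* 2
nonzeroCode -[1+ m ] = suc (m ℕ.* 2)

code : ℤ → ℕ
code (+ 0) = 0
code +[1+ m ] = suc (m ℕ.* 2)
code -[1+ m ] = suc (suc (m ℕ.* 2))

nonzeroCode-injective : ∀ {x y} → x ≢ + 0 → y ≢ + 0 → nonzeroCode x ≡ nonzeroCode y → x ≡ y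
nonzeroCode-injective {+ 0}      x≢0 _ _ = contradiction refl x≢0
nonzeroCode-injective {_} {+ 0}  _ y≢0 _ = contradiction refl y≢0
nonzeroCode-injective {+[1+ m ]} {+[1+ n ]} _ _ eq = cong +[1+_] (ℕₚ.*-cancelʳ-≡ m n 2 eq)
nonzeroCode-injective { -[1+ m ]} { -[1+ n ]} _ _ eq =
  cong -[1+_] (ℕₚ.*-cancelʳ-≡ m n 2 (ℕₚ.suc-injective eq))
nonzeroCode-injective {+[1+ m ]} { -[1+ n ]} _ _ eq = contradiction eq (m*2≢1+n*2 m n)
nonzeroCode-injective { -[1+ m ]} {+[1+ n ]} _ _ eq = contradiction (sym eq) (m*2≢1+n*2 n m)

code-injective : Injective _≡_ _≡_ code
code-injective {+ 0}      {+ 0}      _  = refl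
code-injective {+[1+ _ ]} {+[1+ _ ]} eq = nonzeroCode-injective (λ ()) (λ ()) (ℕₚ.suc-injective eq)
code-injective {+[1+ _ ]} { -[1+ _ ]} eq = nonzeroCode-injective (λ ()) (λ ()) (ℕₚ.suc-injective eq)
code-injective { -[1+ _ ]} {+[1+ _ ]} eq = nonzeroCode-injective (λ ()) (λ ()) (ℕₚ.suc-injective eq)
code-injective { -[1+ _ ]} { -[1+ _ ]} eq = nonzeroCode-injective (λ ()) (λ ()) (ℕₚ.suc-injective eq)

nonzeroCode< : ∀ {x} → x ≢ + 0 → nonzeroCode x ℕ.< ∣ x ∣ ℕ.* 2
nonzeroCode< {+ 0} x≢0 = contradiction refl x≢0
nonzeroCode< {+[1+ m ]} _ = ℕₚ.m<n⇒m<1+n (ℕₚ.n<1+n (m ℕ.* 2))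
nonzeroCode< { -[1+ m ]} _ = ℕₚ.n<1+n (suc (m ℕ.* 2))

code≤ : ∀ x → code x ≤ ∣ x ∣ ℕ.* 2
code≤ (+ 0)      = ℕ.z≤n
code≤ +[1+ m ]   = nonzeroCode< {+[1+ m ]} λ ()
code≤ -[1+ m ]   = nonzeroCode< { -[1+ m ]} λ ()

m≤K⇒m*2≤K+K : ∀ {m K} → m ≤ K → m ℕ.* 2 ≤ K ℕ.+ K
m≤K⇒m*2≤K+K {m} {K} m≤K = subst (m ℕ.* 2 ≤_) (sym (K+K≡K*2 K)) (ℕₚ.*-monoˡ-≤ 2 m≤K)

distinctColours≤ : ∀ {d} n (c : Fin d → ℤ) → (∀ j → InM n (c j)) → Injective _≡_ _≡_ c → d ≤ n
distinctColours≤ n c c∈M c-inj with parityView n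
... | even K = injective⇒≤ {f = λ j → Fin.fromℕ< (code< j)} λ {i} {j} eq →
      c-inj (nonzeroCode-injective (c≢0 i) (c≢0 j) (Finₚ.fromℕ<-injective _ _ (code< i) (code< j) eq))
  where
  c≢0 : ∀ j → c j ≢ + 0
  c≢0 j = proj₂ (Equivalence.to (InM-even K) (c∈M j))

  code< : ∀ j → nonzeroCode (c j) ℕ.< K ℕ.+ K
  code< j = ℕₚ.<-≤-trans (nonzeroCode< (c≢0 j))
                         (m≤K⇒m*2≤K+K (proj₁ (Equivalence.to (InM-even K) (c∈M j))))
... | odd K = injective⇒≤ {f = λ j → Fin.fromℕ< (code< j)} λ {i} {j} eq →
      c-inj (code-injective (Finₚ.fromℕ<-injective _ _ (code< i) (code< j) eq))
  where
  code< : ∀ j → code (c j) ℕ.< suc (K ℕ.+ K)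
  code< j = ℕ.s≤s (ℕₚ.≤-trans (code≤ (c j)) (m≤K⇒m*2≤K+K (Equivalence.to (InM-odd K) (c∈M j))))

neighbours≤colours : ∀ {m n d} {G : Graph m} {s : Signature G} → Colorable n G s →
                     ∀ u (v : Fin d → Fin m) → Injective _≡_ _≡_ v → (∀ j → G u (v j) ≡ true) → d ≤ n
neighbours≤colours {n = n} (f , f∈M , _ , f-proper) u v v-inj adj =
  distinctColours≤ n (f u ∘ v) (λ j → f∈M u (v j) (adj j)) λ {i} {j} eq →
    decidable-stable (i Finₚ.≟ j) λ i≢j → f-proper u (v i) (v j) (adj i) (adj j) (i≢j ∘ v-inj) eq

indicator≤1 : ∀ b → (if b then 1 else 0) ≤ 1
indicator≤1 true  = ℕₚ.≤-refl
indicator≤1 false = ℕ.z≤n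

count : ∀ {m} → (Fin m → Bool) → ℕ
count b = sum (tabulate λ v → if b v then 1 else 0)

count≤ : ∀ {m} (b : Fin m → Bool) → count b ≤ m
count≤ {zero}  b = ℕ.z≤n
count≤ {suc m} b = ℕₚ.+-mono-≤ (indicator≤1 (b zero)) (count≤ (b ∘ suc))

count< : ∀ {m} (b : Fin m → Bool) i → b i ≡ false → count b ℕ.< m
count< b zero    bi≡false rewrite bi≡false = ℕ.s≤s (count≤ (b ∘ suc))
count< b (suc i) bi≡false = ℕₚ.+-mono-≤-< (indicator≤1 (b zero)) (count< (b ∘ suc) i bi≡false)

count-true : ∀ m → count {m} (λ _ → true) ≡ m
count-true zero    = refl
count-true (suc m) = cong suc (count-true m)

degree≡count : ∀ {m} (G : Graph m) u → degree G u ≡ count (G u)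
degree≡count G u = cong sum (map-tabulate id λ v → if G u v then 1 else 0)

degree-loopless : ∀ {m} (G : Graph m) u → G u u ≡ false → degree G u ℕ.< m
degree-loopless G u loop = subst (ℕ._< _) (sym (degree≡count G u)) (count< (G u) u loop)

max≤ : ∀ {m d} (f : Fin m → ℕ) → (∀ v → f v ≤ d) → foldr _⊔_ 0 (tabulate f) ≤ d
max≤ {zero}  f _   = ℕ.z≤n
max≤ {suc m} f f≤d = ℕₚ.⊔-lub (f≤d zero) (max≤ (f ∘ suc) (f≤d ∘ suc))

≤max : ∀ {m} (f : Fin m → ℕ) u → f u ≤ foldr _⊔_ 0 (tabulate f)
≤max f zero    = ℕₚ.m≤m⊔n (f zero) _
≤max f (suc u) = ℕₚ.≤-trans (≤max (f ∘ suc) u) (ℕₚ.m≤n⊔m (f zero) _)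

Δ-attained : ∀ {m} (G : Graph m) u → (∀ v → degree G v ≤ degree G u) → Δ G ≡ degree G u
Δ-attained G u maximal = trans (cong (foldr _⊔_ 0) (map-tabulate id (degree G)))
  (ℕₚ.≤-antisym (max≤ (degree G) maximal) (≤max (degree G) u))

1+n≡ᵇn : ∀ n → (suc n ℕ.≡ᵇ n) ≡ false
1+n≡ᵇn zero    = refl
1+n≡ᵇn (suc n) = 1+n≡ᵇn n

wheel-loopless : ∀ k (i : Fin (suc (suc k))) → wheelAdj (suc (suc k)) (suc i) (suc i) ≡ false
wheel-loopless k i with toℕ i
... | zero  = refl
... | suc r rewrite 1+n≡ᵇn r = refl

Δ-wheel : ∀ k → 2 ≤ k → Δ (wheelAdj k) ≡ k
Δ-wheel (suc zero) (ℕ.s≤s ())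
Δ-wheel (suc (suc k)) _ = trans (Δ-attained G zero maximal) hub-degree
  where
  G : Graph (suc (suc (suc k)))
  G = wheelAdj (suc (suc k))

  hub-degree : degree G zero ≡ suc (suc k)
  hub-degree = trans (degree≡count G zero) (count-true (suc (suc k)))

  maximal : ∀ v → degree G v ≤ degree G zero
  maximal zero    = ℕₚ.≤-refl
  maximal (suc i) =
    subst (degree G (suc i) ≤_) (sym hub-degree)
          (ℕ.s≤s⁻¹ (degree-loopless G (suc i) (wheel-loopless k i)))

theorem5 : (n : ℕ) → 4 ≤ n → Class1± (Wheel n)
theorem5 (suc k) (ℕ.s≤s 3≤k) s rewrite Δ-wheel k (ℕₚ.≤-trans (ℕₚ.n≤1+n 2) 3≤k) =
    ℕₚ.≤-trans (ℕ.s≤s ℕ.z≤n) 3≤k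
  , wheel-colorable 3≤k (rimLabelling k 3≤k) s
  , λ m _ m<k colorable → ℕₚ.<⇒≱ m<k (neighbours≤colours {s = s} colorable zero suc Finₚ.suc-injective λ _ → refl)
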